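{- For $n\ge1$, $F_n(1;1,z,1,1)=\sum_{j=0}^{n-1}M(n,j)z^j$, where $$M(n,j)=(n-j-1)!\,\bigl[(n-j)^{j+1}-(n-j-1)^{j+1}\bigr].$$
   Context: An inversion sequence of length $n$ is a sequence $e=(e_0,\dots,e_{n-1})$ of integers with $0\le e_i\le i$; $I_n$ is the set of them. For $e\in I_n$: $\mathrm{inv}(e)=|\{(i,j):i<j,\ e_i>e_j\}|$, $\mathrm{sum}(e)=\sum_i e_i$, $\mathrm{noz}(e)$ = number of zero entries, $\mathrm{tel}(e)=n-(\text{number of distinct entries of }e)$, $\mathrm{uel}(e)=n-\max(e)-1$. $F_n(x;y,z,p,q)=\sum_{e\in I_n}x^{\mathrm{noz}(e)}y^{\mathrm{tel}(e)}z^{\mathrm{uel}(e)}p^{\mathrm{sum}(e)}q^{\mathrm{inv}(e)}$. Thus $F_n(1;1,z,1,1)=\sum_{e\in I_n}z^{\mathrm{uel}(e)}$. Here $0^{m}=0$ for $m\ge1$. -}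

module Defs where

open import Data.Nat using (ℕ; zero; suc; _+_; _*_; _∸_; _^_; _⊔_; _!)
open import Data.List using (List; []; _∷_; map; concatMap; upTo; length; foldr; _∷ʳ_)
open import Data.Nat.ListAction using (sum)

-- Inversion sequences of length n: lists (e₀,…,e_{n-1}) with 0 ≤ eᵢ ≤ i.
-- I (suc n) is obtained from I n by appending a last entry eₙ ∈ {0,…,n}.
-- Every inversion sequence appears exactly once.
I : ℕ → List (List ℕ)
I zero    = [] ∷ []
I (suc n) = concatMap (λ e → map (λ k → e ∷ʳ k) (upTo (suc n))) (I n)

-- maximum entry (entries are ≥ 0; for n ≥ 1 this is max(e))
maxEntry : List ℕ → ℕ
maxEntry = foldr _⊔_ 0

uel : List ℕ → ℕ
uel e = length e ∸ maxEntry e ∸ 1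

-- F_n(1;1,z,1,1) = Σ_{e ∈ I_n} z^{uel(e)}
F-uel : ℕ → ℕ → ℕ
F-uel n z = sum (map (λ e → z ^ uel e) (I n))

M : ℕ → ℕ → ℕ
M n j = (n ∸ j ∸ 1) ! * ((n ∸ j) ^ (j + 1) ∸ (n ∸ j ∸ 1) ^ (j + 1))

-- Let R(n,m) count the inversion sequences of length n with all entries below m. Entry i then
-- ranges independently over {0,…,min(i,m-1)}, so R(n,m) = ∏ᵢ min(i+1,m) = m!·m^(n-m) for
-- 1 ≤ m ≤ n, and M(n,n-1-m) = R(n,m+1) - R(n,m) is the number of sequences with maximum m,
-- i.e. with uel = n-1-m. Grouping the terms z^uel of F_n by the maximum gives the formula.
module Submission where

open import Defs
open import Data.Nat using (ℕ; zero; suc; _≤_; _<_; _*_; _^_; _+_; _∸_; _⊔_; _⊓_; _!; z≤n; s≤s)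
open import Data.Nat.Properties
open import Data.List using (List; []; _∷_; map; upTo; _++_; [_]; _∷ʳ_; concatMap; length)
open import Data.List.Properties using (upTo-∷ʳ; map-++; map-∘; map-cong; map-cong-local; length-++)
open import Data.List.Relation.Unary.All as All using (All; []; _∷_)
open import Data.List.Relation.Unary.All.Properties using (concat⁺; map⁺; applyUpTo⁺₁)
open import Data.Nat.ListAction using (sum)
open import Data.Nat.ListAction.Properties using (sum-++)
open import Data.Product using (_,_)
open import Function using (_∘_)
open import Algebra.Properties.CommutativeSemigroup +-commutativeSemigroup using (interchange)
open import Relation.Binary.PropositionalEquality hiding ([_])
open ≡-Reasoning

∑ : ℕ → (ℕ → ℕ) → ℕ
∑ zero    f = 0
∑ (suc n) f = ∑ n f + f n

sum-map-upTo : ∀ f n → sum (map f (upTo n)) ≡ ∑ n f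
sum-map-upTo f zero    = refl
sum-map-upTo f (suc n) = begin
  sum (map f (upTo (suc n)))       ≡⟨ cong (sum ∘ map f) (sym (upTo-∷ʳ n)) ⟩
  sum (map f (upTo n ∷ʳ n))        ≡⟨ cong sum (map-++ f (upTo n) [ n ]) ⟩
  sum (map f (upTo n) ++ [ f n ])  ≡⟨ sum-++ (map f (upTo n)) [ f n ] ⟩
  sum (map f (upTo n)) + (f n + 0) ≡⟨ cong₂ _+_ (sum-map-upTo f n) (+-identityʳ (f n)) ⟩
  ∑ n f + f n                      ∎

∑-cong : ∀ n {f g : ℕ → ℕ} → (∀ i → i < n → f i ≡ g i) → ∑ n f ≡ ∑ n g
∑-cong zero    f≡g = refl
∑-cong (suc n) f≡g = cong₂ _+_ (∑-cong n (λ i i<n → f≡g i (m<n⇒m<1+n i<n))) (f≡g n (n<1+n n))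

∑-distrib-+ : ∀ n f g → ∑ n (λ i → f i + g i) ≡ ∑ n f + ∑ n g
∑-distrib-+ zero    f g = refl
∑-distrib-+ (suc n) f g =
  trans (cong (_+ (f n + g n)) (∑-distrib-+ n f g)) (interchange (∑ n f) (∑ n g) (f n) (g n))

∑-distribˡ-* : ∀ n c f → ∑ n (λ i → c * f i) ≡ c * ∑ n f
∑-distribˡ-* zero    c f = sym (*-zeroʳ c)
∑-distribˡ-* (suc n) c f =
  trans (cong (_+ c * f n) (∑-distribˡ-* n c f)) (sym (*-distribˡ-+ c (∑ n f) (f n)))

∑-shift : ∀ n f → ∑ (suc n) f ≡ f 0 + ∑ n (f ∘ suc)
∑-shift zero    f = +-comm 0 (f 0)
∑-shift (suc n) f = trans (cong (_+ f (suc n)) (∑-shift n f)) (+-assoc (f 0) _ _)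

∑-reverse : ∀ n f → ∑ (suc n) f ≡ ∑ (suc n) (λ i → f (n ∸ i))
∑-reverse zero    f = refl
∑-reverse (suc n) f = begin
  ∑ (suc n) f + f (suc n)                 ≡⟨ cong (_+ f (suc n)) (∑-reverse n f) ⟩
  ∑ (suc n) (λ i → f (n ∸ i)) + f (suc n) ≡⟨ +-comm _ (f (suc n)) ⟩
  f (suc n) + ∑ (suc n) (λ i → f (n ∸ i)) ≡⟨ sym (∑-shift (suc n) (λ i → f (suc n ∸ i))) ⟩
  ∑ (suc (suc n)) (λ i → f (suc n ∸ i))   ∎

sum-map-concatMap : ∀ {A B : Set} (g : B → ℕ) (F : A → List B) L →
  sum (map g (concatMap F L)) ≡ sum (map (λ a → sum (map g (F a))) L)
sum-map-concatMap g F []      = refl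
sum-map-concatMap g F (a ∷ L) = begin
  sum (map g (F a ++ concatMap F L))              ≡⟨ cong sum (map-++ g (F a) (concatMap F L)) ⟩
  sum (map g (F a) ++ map g (concatMap F L))      ≡⟨ sum-++ (map g (F a)) _ ⟩
  sum (map g (F a)) + sum (map g (concatMap F L)) ≡⟨ cong (sum (map g (F a)) +_) (sum-map-concatMap g F L) ⟩
  sum (map (λ a → sum (map g (F a))) (a ∷ L))     ∎

sum-map-*ʳ : ∀ {A : Set} (g : A → ℕ) c L → sum (map (λ a → g a * c) L) ≡ sum (map g L) * c
sum-map-*ʳ g c []      = refl
sum-map-*ʳ g c (a ∷ L) = trans (cong (g a * c +_) (sum-map-*ʳ g c L)) (sym (*-distribʳ-+ c (g a) _))

𝟙[_<_] : ℕ → ℕ → ℕ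
𝟙[ _     < zero  ] = 0
𝟙[ zero  < suc m ] = 1
𝟙[ suc x < suc m ] = 𝟙[ x < m ]

𝟙-⊔ : ∀ a b m → 𝟙[ a ⊔ b < m ] ≡ 𝟙[ a < m ] * 𝟙[ b < m ]
𝟙-⊔ a       b       zero    = refl
𝟙-⊔ zero    b       (suc m) = sym (+-identityʳ _)
𝟙-⊔ (suc a) zero    (suc m) = sym (*-identityʳ _)
𝟙-⊔ (suc a) (suc b) (suc m) = 𝟙-⊔ a b m

⊓-+-𝟙 : ∀ k m → k ⊓ m + 𝟙[ k < m ] ≡ suc k ⊓ m
⊓-+-𝟙 zero    zero    = refl
⊓-+-𝟙 (suc k) zero    = refl
⊓-+-𝟙 zero    (suc m) = refl
⊓-+-𝟙 (suc k) (suc m) = cong suc (⊓-+-𝟙 k m)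

∑-𝟙 : ∀ n m → ∑ n (λ k → 𝟙[ k < m ]) ≡ n ⊓ m
∑-𝟙 zero    m = refl
∑-𝟙 (suc n) m = trans (cong (_+ 𝟙[ n < m ]) (∑-𝟙 n m)) (⊓-+-𝟙 n m)

𝟙-telescope : ∀ {x B} (h : ℕ → ℕ) → x < B →
  h x + ∑ B (λ m → 𝟙[ x < m ] * h m) ≡ ∑ B (λ m → 𝟙[ x < suc m ] * h m)
𝟙-telescope {zero} {suc B} h _ = begin
  h 0 + ∑ (suc B) (λ m → 𝟙[ 0 < m ] * h m) ≡⟨ cong (h 0 +_) (∑-shift B _) ⟩
  h 0 + ∑ B (λ m → 1 * h (suc m))          ≡⟨ cong (_+ ∑ B (λ m → 1 * h (suc m))) (sym (*-identityˡ (h 0))) ⟩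
  1 * h 0 + ∑ B (λ m → 1 * h (suc m))      ≡⟨ sym (∑-shift B _) ⟩
  ∑ (suc B) (λ m → 1 * h m)                ∎
𝟙-telescope {suc x} {suc B} h (s≤s x<B) = begin
  h (suc x) + ∑ (suc B) (λ m → 𝟙[ suc x < m ] * h m) ≡⟨ cong (h (suc x) +_) (∑-shift B _) ⟩
  h (suc x) + ∑ B (λ m → 𝟙[ x < m ] * h (suc m))     ≡⟨ 𝟙-telescope (h ∘ suc) x<B ⟩
  ∑ B (λ m → 𝟙[ x < suc m ] * h (suc m))             ≡⟨ sym (∑-shift B _) ⟩
  ∑ (suc B) (λ m → 𝟙[ suc x < suc m ] * h m)         ∎

count< : {A : Set} → (A → ℕ) → List A → ℕ → ℕ
count< v L m = sum (map (λ a → 𝟙[ v a < m ]) L)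

-- Abel summation in the form Σₐ h(v a) = Σₘ (count< v L (m+1) - count< v L m) h m,
-- with the subtracted terms moved to the left so that no truncated subtraction occurs.
sum-by-count< : ∀ {A : Set} (v : A → ℕ) (h : ℕ → ℕ) {B} {L} → All (λ a → v a < B) L →
  sum (map (h ∘ v) L) + ∑ B (λ m → count< v L m * h m) ≡ ∑ B (λ m → count< v L (suc m) * h m)
sum-by-count< v h []                          = refl
sum-by-count< v h {B} {a ∷ L} (va<B ∷ vL<B) = begin
  (h (v a) + S) + ∑ B (λ m → (𝟙[ v a < m ] + count< v L m) * h m)
    ≡⟨ cong ((h (v a) + S) +_) (split (λ m → 𝟙[ v a < m ]) (count< v L)) ⟩
  (h (v a) + S) + (∑ B (λ m → 𝟙[ v a < m ] * h m) + ∑ B (λ m → count< v L m * h m))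
    ≡⟨ interchange (h (v a)) S _ _ ⟩
  (h (v a) + ∑ B (λ m → 𝟙[ v a < m ] * h m)) + (S + ∑ B (λ m → count< v L m * h m))
    ≡⟨ cong₂ _+_ (𝟙-telescope h va<B) (sum-by-count< v h vL<B) ⟩
  ∑ B (λ m → 𝟙[ v a < suc m ] * h m) + ∑ B (λ m → count< v L (suc m) * h m)
    ≡⟨ sym (split (λ m → 𝟙[ v a < suc m ]) (λ m → count< v L (suc m))) ⟩
  ∑ B (λ m → (𝟙[ v a < suc m ] + count< v L (suc m)) * h m) ∎
  where
    S = sum (map (h ∘ v) L)
    split : (f g : ℕ → ℕ) → ∑ B (λ m → (f m + g m) * h m) ≡ ∑ B (λ m → f m * h m) + ∑ B (λ m → g m * h m)
    split f g = trans (∑-cong B (λ m _ → *-distribʳ-+ (h m) (f m) (g m))) (∑-distrib-+ B _ _)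

All-I : (P : ℕ → List ℕ → Set) → P 0 [] →
  (∀ {n e k} → k ≤ n → P n e → P (suc n) (e ∷ʳ k)) → ∀ n → All (P n) (I n)
All-I P P[] P∷ʳ zero    = P[] ∷ []
All-I P P[] P∷ʳ (suc n) = concat⁺ (map⁺ (All.map extend (All-I P P[] P∷ʳ n)))
  where
    extend : ∀ {e} → P n e → All (P (suc n)) (map (e ∷ʳ_) (upTo (suc n)))
    extend Pe = map⁺ (applyUpTo⁺₁ _ (suc n) (λ k<1+n → P∷ʳ (m<1+n⇒m≤n k<1+n) Pe))

maxEntry-∷ʳ : ∀ e k → maxEntry (e ∷ʳ k) ≡ maxEntry e ⊔ k
maxEntry-∷ʳ []      k = ⊔-identityʳ k
maxEntry-∷ʳ (x ∷ e) k = trans (cong (x ⊔_) (maxEntry-∷ʳ e k)) (sym (⊔-assoc x (maxEntry e) k))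

I-length : ∀ n → All (λ e → length e ≡ n) (I n)
I-length = All-I (λ n e → length e ≡ n) refl
  (λ {_} {e} _ len → trans (length-++ e) (trans (+-comm _ 1) (cong suc len)))

I-maxEntry : ∀ n → All (λ e → maxEntry e ≤ n ∸ 1) (I n)
I-maxEntry = All-I (λ n e → maxEntry e ≤ n ∸ 1) z≤n
  (λ {n} {e} {k} k≤n max≤ → subst (_≤ n) (sym (maxEntry-∷ʳ e k)) (⊔-lub (≤-trans max≤ (m∸n≤m n 1)) k≤n))

uel-I : ∀ n → All (λ e → uel e ≡ n ∸ maxEntry e) (I (suc n))
uel-I n = All.map (λ {e} len → begin
  length e ∸ maxEntry e ∸ 1 ≡⟨ cong (λ l → l ∸ maxEntry e ∸ 1) len ⟩
  suc n ∸ maxEntry e ∸ 1    ≡⟨ ∸-+-assoc (suc n) (maxEntry e) 1 ⟩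
  suc n ∸ (maxEntry e + 1)  ≡⟨ cong (suc n ∸_) (+-comm (maxEntry e) 1) ⟩
  n ∸ maxEntry e            ∎) (I-length (suc n))

boundedCount : ℕ → ℕ → ℕ
boundedCount zero    m = 𝟙[ 0 < m ]
boundedCount (suc n) m = boundedCount n m * (suc n ⊓ m)

count<-I : ∀ n m → count< maxEntry (I n) m ≡ boundedCount n m
count<-I zero    m = +-identityʳ _
count<-I (suc n) m = begin
  count< maxEntry (I (suc n)) m                        ≡⟨ sum-map-concatMap g extend (I n) ⟩
  sum (map (λ e → sum (map g (extend e))) (I n))       ≡⟨ cong sum (map-cong extensions (I n)) ⟩
  sum (map (λ e → g e * (suc n ⊓ m)) (I n))            ≡⟨ sum-map-*ʳ g _ (I n) ⟩
  count< maxEntry (I n) m * (suc n ⊓ m)                ≡⟨ cong (_* (suc n ⊓ m)) (count<-I n m) ⟩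
  boundedCount n m * (suc n ⊓ m)                       ∎
  where
    g : List ℕ → ℕ
    g e = 𝟙[ maxEntry e < m ]
    extend : List ℕ → List (List ℕ)
    extend e = map (e ∷ʳ_) (upTo (suc n))
    extensions : ∀ e → sum (map g (extend e)) ≡ g e * (suc n ⊓ m)
    extensions e = begin
      sum (map g (extend e))                      ≡⟨ cong sum (sym (map-∘ (upTo (suc n)))) ⟩
      sum (map (λ k → g (e ∷ʳ k)) (upTo (suc n))) ≡⟨ sum-map-upTo _ (suc n) ⟩
      ∑ (suc n) (λ k → g (e ∷ʳ k))
        ≡⟨ ∑-cong (suc n) (λ k _ → trans (cong 𝟙[_< m ] (maxEntry-∷ʳ e k)) (𝟙-⊔ (maxEntry e) k m)) ⟩
      ∑ (suc n) (λ k → g e * 𝟙[ k < m ]) ≡⟨ ∑-distribˡ-* (suc n) (g e) _ ⟩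
      g e * ∑ (suc n) (λ k → 𝟙[ k < m ]) ≡⟨ cong (g e *_) (∑-𝟙 (suc n) m) ⟩
      g e * (suc n ⊓ m)                  ∎

boundedCount-≤ : ∀ {i m} → i ≤ suc m → boundedCount i (suc m) ≡ i !
boundedCount-≤ {zero}      _   = refl
boundedCount-≤ {suc i} {m} i<1+m = begin
  boundedCount i (suc m) * (suc i ⊓ suc m) ≡⟨ cong₂ _*_ (boundedCount-≤ (<⇒≤ i<1+m)) (m≤n⇒m⊓n≡m i<1+m) ⟩
  i ! * suc i                              ≡⟨ *-comm (i !) (suc i) ⟩
  suc i !                                  ∎

boundedCount-+ : ∀ m k → boundedCount (suc m + k) (suc m) ≡ suc m ! * suc m ^ k
boundedCount-+ m zero = begin
  boundedCount (suc m + 0) (suc m) ≡⟨ cong (λ i → boundedCount i (suc m)) (+-identityʳ (suc m)) ⟩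
  boundedCount (suc m) (suc m)     ≡⟨ boundedCount-≤ {suc m} ≤-refl ⟩
  suc m !                          ≡⟨ sym (*-identityʳ _) ⟩
  suc m ! * 1                      ∎
boundedCount-+ m (suc k) = begin
  boundedCount (suc m + suc k) (suc m)
    ≡⟨ cong (λ i → boundedCount i (suc m)) (+-suc (suc m) k) ⟩
  boundedCount (suc m + k) (suc m) * (suc (suc m + k) ⊓ suc m)
    ≡⟨ cong₂ _*_ (boundedCount-+ m k) (m≥n⇒m⊓n≡n (≤-trans (m≤m+n (suc m) k) (n≤1+n _))) ⟩
  (suc m ! * suc m ^ k) * suc m ≡⟨ *-assoc (suc m !) _ (suc m) ⟩
  suc m ! * (suc m ^ k * suc m) ≡⟨ cong (suc m ! *_) (*-comm (suc m ^ k) (suc m)) ⟩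
  suc m ! * suc m ^ suc k       ∎

boundedCount-+-suc : ∀ m k → boundedCount (m + suc k) m ≡ m ! * m ^ suc k
boundedCount-+-suc zero    k = *-zeroʳ (boundedCount k 0)
boundedCount-+-suc (suc m) k = boundedCount-+ m (suc k)

M-difference : ∀ {m n} → m ≤ n → M (suc n) (n ∸ m) + boundedCount (suc n) m ≡ boundedCount (suc n) (suc m)
M-difference {m} m≤n with m≤n⇒∃[o]m+o≡n m≤n
... | j , refl rewrite m+n∸m≡n m j = begin
  M (suc (m + j)) j + boundedCount (suc (m + j)) m
    ≡⟨ cong₂ _+_ M-value (trans (cong (λ i → boundedCount i m) (sym (+-suc m j))) (boundedCount-+-suc m j)) ⟩
  m ! * (suc m ^ suc j ∸ m ^ suc j) + m ! * m ^ suc j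
    ≡⟨ sym (*-distribˡ-+ (m !) _ (m ^ suc j)) ⟩
  m ! * ((suc m ^ suc j ∸ m ^ suc j) + m ^ suc j)
    ≡⟨ cong (m ! *_) (m∸n+n≡m (^-monoˡ-≤ (suc j) (n≤1+n m))) ⟩
  m ! * (suc m * suc m ^ j) ≡⟨ sym (*-assoc (m !) (suc m) _) ⟩
  m ! * suc m * suc m ^ j   ≡⟨ cong (_* suc m ^ j) (*-comm (m !) (suc m)) ⟩
  suc m ! * suc m ^ j       ≡⟨ sym (boundedCount-+ m j) ⟩
  boundedCount (suc (m + j)) (suc m) ∎
  where
    M-value : M (suc (m + j)) j ≡ m ! * (suc m ^ suc j ∸ m ^ suc j)
    M-value = cong₂ (λ t e → (t ∸ 1) ! * (t ^ e ∸ (t ∸ 1) ^ e)) (m+n∸n≡m (suc m) j) (+-comm j 1)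

F-uel-telescope : ∀ n z →
  F-uel (suc n) z + ∑ (suc n) (λ m → boundedCount (suc n) m * z ^ (n ∸ m))
    ≡ ∑ (suc n) (λ m → boundedCount (suc n) (suc m) * z ^ (n ∸ m))
F-uel-telescope n z = begin
  F-uel (suc n) z + ∑ (suc n) (λ m → boundedCount (suc n) m * h m)
    ≡⟨ cong₂ _+_ F-uel-by-max (∑-cong (suc n) (λ m _ → cong (_* h m) (sym (count<-I (suc n) m)))) ⟩
  sum (map (h ∘ maxEntry) (I (suc n))) + ∑ (suc n) (λ m → count< maxEntry (I (suc n)) m * h m)
    ≡⟨ sum-by-count< maxEntry h (All.map s≤s (I-maxEntry (suc n))) ⟩
  ∑ (suc n) (λ m → count< maxEntry (I (suc n)) (suc m) * h m)
    ≡⟨ ∑-cong (suc n) (λ m _ → cong (_* h m) (count<-I (suc n) (suc m))) ⟩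
  ∑ (suc n) (λ m → boundedCount (suc n) (suc m) * h m) ∎
  where
    h : ℕ → ℕ
    h m = z ^ (n ∸ m)
    F-uel-by-max : F-uel (suc n) z ≡ sum (map (h ∘ maxEntry) (I (suc n)))
    F-uel-by-max = cong sum (map-cong-local (All.map (cong (z ^_)) (uel-I n)))

M-telescope : ∀ n z →
  sum (map (λ j → M (suc n) j * z ^ j) (upTo (suc n)))
    + ∑ (suc n) (λ m → boundedCount (suc n) m * z ^ (n ∸ m))
    ≡ ∑ (suc n) (λ m → boundedCount (suc n) (suc m) * z ^ (n ∸ m))
M-telescope n z = begin
  sum (map (λ j → M (suc n) j * z ^ j) (upTo (suc n))) + B
    ≡⟨ cong (_+ B) (trans (sum-map-upTo _ (suc n)) (∑-reverse n (λ j → M (suc n) j * z ^ j))) ⟩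
  ∑ (suc n) (λ m → M (suc n) (n ∸ m) * z ^ (n ∸ m)) + B
    ≡⟨ sym (∑-distrib-+ (suc n) _ _) ⟩
  ∑ (suc n) (λ m → M (suc n) (n ∸ m) * z ^ (n ∸ m) + boundedCount (suc n) m * z ^ (n ∸ m))
    ≡⟨ ∑-cong (suc n) (λ m m<1+n → trans (sym (*-distribʳ-+ (z ^ (n ∸ m)) (M (suc n) (n ∸ m)) (boundedCount (suc n) m)))
                                         (cong (_* z ^ (n ∸ m)) (M-difference (m<1+n⇒m≤n m<1+n)))) ⟩
  ∑ (suc n) (λ m → boundedCount (suc n) (suc m) * z ^ (n ∸ m)) ∎
  where
    B = ∑ (suc n) (λ m → boundedCount (suc n) m * z ^ (n ∸ m))

mainTheorem3 : (n : ℕ) → 1 ≤ n → (z : ℕ) →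
    F-uel n z ≡ sum (map (λ j → M n j * z ^ j) (upTo n))
mainTheorem3 (suc n) _ z = +-cancelʳ-≡ _ _ _ (trans (F-uel-telescope n z) (sym (M-telescope n z)))
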